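{- Let $tp$ and $p$ be $\mathrm{IMP}^{\mathrm{TC}}$ programs, and let $s, s', s_1, s_2, s_3$ be states. 1. If $p, s \Rightarrow^{n} (s', 0)$ in the flagged relation, then $tp \vdash p, s \Rightarrow^{n} s'$. 2. If $p, s_1 \Rightarrow^{n_1} (s_2, 1)$ in the flagged relation and $tp \vdash tp, s_2 \Rightarrow^{n_2} s_3$, then $tp \vdash p, s_1 \Rightarrow^{n_1+n_2} s_3$.
   Context: **States and expressions.** Registers are strings, and states are functions $s : \mathrm{string} \to \mathbb{N}$; $s[r:=v]$ denotes a state update. Atoms are constants $n \in \mathbb{N}$ or registers $r$, with $\mathrm{aval}(n,s)=n$ and $\mathrm{aval}(r,s)=s(r)$. Arithmetic expressions are atoms or $A_1 \pm A_2$ with $A_1, A_2$ atoms, using truncated subtraction. **IMP^W.** $\mathrm{IMP}^{\mathrm{W}}$ has assignment $r := a$, sequencing $;$, $\mathrm{IF}\ r\neq 0\ \mathrm{THEN}\ p_1\ \mathrm{ELSE}\ p_2$, and $\mathrm{WHILE}\ r \neq 0\ \mathrm{DO}\ p$. Its exact-time big-step relation $p,s\Rightarrow^n s'$ is the standard one, with fixed constant costs per construct. We write $pc, s \Rightarrow^{n}_{r} v$ to mean: there exist $n' \le n$ and $s''$ with $pc, s \Rightarrow^{n'} s''$ and $s''(r) = v$. **IMP^TC.** $\mathrm{IMP}^{\mathrm{TC}}$ commands are $r := a$, $p_1;p_2$, $\mathrm{IF}\ r\neq 0\ \mathrm{THEN}\ p_1\ \mathrm{ELSE}\ p_2$, $\mathrm{CALL}\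 pc\ \mathrm{RETURN}\ r$ (where $pc$ is an $\mathrm{IMP}^{\mathrm{W}}$ program), and $\mathrm{RECURSE}$. Its execution relation $tp \vdash p, s \Rightarrow^n s'$, taken in the context of a program $tp$, is defined inductively: - $tp \vdash r:=a, s \Rightarrow^{C_a} s[r:=\mathrm{aval}(a,s)]$. - If $tp\vdash p_1,s\Rightarrow^{n_1}s'$ and $tp\vdash p_2,s'\Rightarrow^{n_2}s''$, then $tp\vdash p_1;p_2,s\Rightarrow^{n_1+n_2+C_s}s''$. - If $s(r)\neq0$ and $tp\vdash p_1,s\Rightarrow^n s'$, then the IF command goes from $s$ to $s'$ in $n+C_i$ steps. - If $s(r)=0$ and $tp\vdash p_2,s\Rightarrow^n s'$, then the IF command goes from $s$ to $s'$ in $n+C_i$ steps. - If $pc,s\Rightarrow^n_r v$, then $tp\vdash \mathrm{CALL}\ pc\ \mathrm{RETURN}\ r, s\Rightarrow^{n+C_c} s[r:=v]$. - If $tp\vdash tp,s\Rightarrow^n s'$, then $tp\vdash \mathrm{RECURSE},s\Rightarrow^{n+C_r}s'$. **Flagged relation.** The relation $p, s \Rightarrow^n (s', b)$, with flag $b \in \{0,1\}$, runs $p$ but stops and raises the flag at a tail-recursive call. It is defined inductively by: - $r:=a, s \Rightarrow^{C_a} (s[r:=\mathrm{aval}(a,s)],0)$. - If $s(r)\neq 0$ and $p_1,s\Rightarrow^n(s',b)$, then the IF command goes from $s$ to $(s',b)$ in $n+C_i$ steps. - If $s(r)=0$ and $p_2,s\Rightarrow^n(s',b)$, then the IF command goes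 from $s$ to $(s',b)$ in $n+C_i$ steps. - If $p_1,s\Rightarrow^{n_1}(s',0)$ and $p_2,s'\Rightarrow^{n_2}(s'',b)$, then $p_1;p_2,s\Rightarrow^{n_1+n_2+C_s}(s'',b)$. - If $pc,s\Rightarrow^n_r v$, then $\mathrm{CALL}\ pc\ \mathrm{RETURN}\ r, s\Rightarrow^{n+C_c}(s[r:=v],0)$. - $\mathrm{RECURSE}, s \Rightarrow^{C_r} (s,1)$. The constants $C_a, C_s, C_i, C_c, C_r$ are fixed natural numbers and are the same in both relations. -}

module Defs where

open import Data.Nat using (ℕ; zero; suc; _+_; _∸_; _≤_)
open import Data.String using (String; _≟_)
open import Data.Product using (∃; ∃-syntax; _×_; _,_)
open import Relation.Nullary using (¬_; yes; no)
open import Relation.Binary.PropositionalEquality using (_≡_)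

Reg : Set
Reg = String

State : Set
State = Reg → ℕ

_[_≔_] : State → Reg → ℕ → State
(s [ r ≔ v ]) r' with r' ≟ r
... | yes _ = v
... | no  _ = s r'

data Atom : Set where
  N : ℕ → Atom
  R : Reg → Atom

atomVal : Atom → State → ℕ
atomVal (N n) s = n
atomVal (R r) s = s r

data AExp : Set where
  A    : Atom → AExp
  Plus : Atom → Atom → AExp
  Sub  : Atom → Atom → AExp

aval : AExp → State → ℕ
aval (A a) s = atomVal a s
aval (Plus a b) s = atomVal a s + atomVal b s
aval (Sub a b) s = atomVal a s ∸ atomVal b s   -- truncated subtraction

-- Ca Cs Ci Cc Cr are those of the paper; Cwt / Cwf are the (fixed)
-- costs of a WHILE iteration / WHILE exit in the IMP^W semantics.
record Costs : Set where
  field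
    Ca Cs Ci Cc Cr Cwt Cwf : ℕ

data IMPW : Set where
  _:=_     : Reg → AExp → IMPW
  _⨾_      : IMPW → IMPW → IMPW
  IF_THEN_ELSE_ : Reg → IMPW → IMPW → IMPW
  WHILE_DO_ : Reg → IMPW → IMPW

data IMPTC : Set where
  _:=_     : Reg → AExp → IMPTC
  _⨾_      : IMPTC → IMPTC → IMPTC
  IF_THEN_ELSE_ : Reg → IMPTC → IMPTC → IMPTC
  CALL_RETURN_ : IMPW → Reg → IMPTC
  RECURSE  : IMPTC

module Semantics (C : Costs) where
  open Costs C

  data _,_⇒W_,_ : IMPW → State → ℕ → State → Set where
    assign : ∀ {r a s} → (r := a) , s ⇒W Ca , (s [ r ≔ aval a s ])
    seq    : ∀ {p₁ p₂ s s' s'' n₁ n₂} → p₁ , s ⇒W n₁ , s' → p₂ , s' ⇒W n₂ , s''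
           → (p₁ ⨾ p₂) , s ⇒W (n₁ + n₂ + Cs) , s''
    ifT    : ∀ {r p₁ p₂ s s' n} → ¬ (s r ≡ 0) → p₁ , s ⇒W n , s'
           → (IF r THEN p₁ ELSE p₂) , s ⇒W (n + Ci) , s'
    ifF    : ∀ {r p₁ p₂ s s' n} → s r ≡ 0 → p₂ , s ⇒W n , s'
           → (IF r THEN p₁ ELSE p₂) , s ⇒W (n + Ci) , s'
    whileF : ∀ {r p s} → s r ≡ 0 → (WHILE r DO p) , s ⇒W Cwf , s
    whileT : ∀ {r p s s' s'' n₁ n₂} → ¬ (s r ≡ 0) → p , s ⇒W n₁ , s'
           → (WHILE r DO p) , s' ⇒W n₂ , s''
           → (WHILE r DO p) , s ⇒W (n₁ + n₂ + Cwt) , s''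

  _,_⇒W≤_∣_↦_ : IMPW → State → ℕ → Reg → ℕ → Set
  pc , s ⇒W≤ n ∣ r ↦ v = ∃[ n' ] ∃[ s'' ] (n' ≤ n × pc , s ⇒W n' , s'' × s'' r ≡ v)

  data _⊢_,_⇒_,_ (tp : IMPTC) : IMPTC → State → ℕ → State → Set where
    assign : ∀ {r a s} → tp ⊢ (r := a) , s ⇒ Ca , (s [ r ≔ aval a s ])
    seq    : ∀ {p₁ p₂ s s' s'' n₁ n₂} → tp ⊢ p₁ , s ⇒ n₁ , s' → tp ⊢ p₂ , s' ⇒ n₂ , s''
           → tp ⊢ (p₁ ⨾ p₂) , s ⇒ (n₁ + n₂ + Cs) , s''
    ifT    : ∀ {r p₁ p₂ s s' n} → ¬ (s r ≡ 0) → tp ⊢ p₁ , s ⇒ n , s'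
           → tp ⊢ (IF r THEN p₁ ELSE p₂) , s ⇒ (n + Ci) , s'
    ifF    : ∀ {r p₁ p₂ s s' n} → s r ≡ 0 → tp ⊢ p₂ , s ⇒ n , s'
           → tp ⊢ (IF r THEN p₁ ELSE p₂) , s ⇒ (n + Ci) , s'
    call   : ∀ {pc r s n v} → pc , s ⇒W≤ n ∣ r ↦ v
           → tp ⊢ (CALL pc RETURN r) , s ⇒ (n + Cc) , (s [ r ≔ v ])
    recurse : ∀ {s s' n} → tp ⊢ tp , s ⇒ n , s' → tp ⊢ RECURSE , s ⇒ (n + Cr) , s'

  data _,_⇒F_,_,_ : IMPTC → State → ℕ → State → ℕ → Set where
    assign : ∀ {r a s} → (r := a) , s ⇒F Ca , (s [ r ≔ aval a s ]) , 0
    ifT    : ∀ {r p₁ p₂ s s' n b} → ¬ (s r ≡ 0) → p₁ , s ⇒F n , s' , b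
           → (IF r THEN p₁ ELSE p₂) , s ⇒F (n + Ci) , s' , b
    ifF    : ∀ {r p₁ p₂ s s' n b} → s r ≡ 0 → p₂ , s ⇒F n , s' , b
           → (IF r THEN p₁ ELSE p₂) , s ⇒F (n + Ci) , s' , b
    seq    : ∀ {p₁ p₂ s s' s'' n₁ n₂ b} → p₁ , s ⇒F n₁ , s' , 0 → p₂ , s' ⇒F n₂ , s'' , b
           → (p₁ ⨾ p₂) , s ⇒F (n₁ + n₂ + Cs) , s'' , b
    call   : ∀ {pc r s n v} → pc , s ⇒W≤ n ∣ r ↦ v
           → (CALL pc RETURN r) , s ⇒F (n + Cc) , (s [ r ≔ v ]) , 0
    recurse : ∀ {s} → RECURSE , s ⇒F Cr , s , 1

{-# OPTIONS --safe #-}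
module Submission where

open import Defs
open import Data.Nat using (ℕ; _+_)
open import Data.Nat.Properties using (+-comm; +-assoc; +-commutativeSemigroup)
open import Algebra.Properties.CommutativeSemigroup +-commutativeSemigroup using (xy∙z≈xz∙y)
open import Data.Product using (_×_; _,_)
open import Relation.Binary.PropositionalEquality using (_≡_; cong; subst; sym; trans)

-- A derivation with flag 0 never reaches RECURSE, so it is replayed rule by rule;
-- with flag 1 it ends in a tail call, which is closed off by the given run of tp,
-- whose cost n₂ is pushed past the constructor costs by commuting additions.

module _ (C : Costs) where
  open Costs C
  open Semantics C

  ⊢-retime : ∀ {tp p s s' m n} → m ≡ n → tp ⊢ p , s ⇒ m , s' → tp ⊢ p , s ⇒ n , s'
  ⊢-retime {tp} {p} {s} {s'} = subst (λ k → tp ⊢ p , s ⇒ k , s')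

  unflagged⇒⊢ : ∀ {tp p s s' n} → p , s ⇒F n , s' , 0 → tp ⊢ p , s ⇒ n , s'
  unflagged⇒⊢ assign    = assign
  unflagged⇒⊢ (ifT r d) = ifT r (unflagged⇒⊢ d)
  unflagged⇒⊢ (ifF r d) = ifF r (unflagged⇒⊢ d)
  unflagged⇒⊢ (seq d e) = seq (unflagged⇒⊢ d) (unflagged⇒⊢ e)
  unflagged⇒⊢ (call c)  = call c

  flagged⇒⊢ : ∀ {tp p s₁ s₂ s₃ n₁ n₂} → p , s₁ ⇒F n₁ , s₂ , 1 → tp ⊢ tp , s₂ ⇒ n₂ , s₃
            → tp ⊢ p , s₁ ⇒ (n₁ + n₂) , s₃
  flagged⇒⊢ {n₂ = n₂} (ifT {n = n} r d) t =
    ⊢-retime (sym (xy∙z≈xz∙y n Ci n₂)) (ifT r (flagged⇒⊢ d t))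
  flagged⇒⊢ {n₂ = n₂} (ifF {n = n} r d) t =
    ⊢-retime (sym (xy∙z≈xz∙y n Ci n₂)) (ifF r (flagged⇒⊢ d t))
  flagged⇒⊢ {n₂ = n₂} (seq {n₁ = a} {n₂ = b} d e) t =
    ⊢-retime (sym (trans (xy∙z≈xz∙y (a + b) Cs n₂) (cong (_+ Cs) (+-assoc a b n₂))))
             (seq (unflagged⇒⊢ d) (flagged⇒⊢ e t))
  flagged⇒⊢ {n₂ = n₂} recurse t = ⊢-retime (+-comm n₂ Cr) (recurse t)

mainTheorem2 : (C : Costs) → let open Semantics C in
    (∀ (tp p : IMPTC) (s s' : State) (n : ℕ) → p , s ⇒F n , s' , 0 → tp ⊢ p , s ⇒ n , s')
    × (∀ (tp p : IMPTC) (s₁ s₂ s₃ : State) (n₁ n₂ : ℕ) → p , s₁ ⇒F n₁ , s₂ , 1 → tp ⊢ tp , s₂ ⇒ n₂ , s₃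
        → tp ⊢ p , s₁ ⇒ (n₁ + n₂) , s₃)
mainTheorem2 C = (λ _ _ _ _ _ → unflagged⇒⊢ C) , (λ _ _ _ _ _ _ _ → flagged⇒⊢ C)
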